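{- Let $T$ be a tree on $n$ vertices with maximum degree $D$, let $0<\eta<1$, and let $T_S$ be the skeleton obtained from $T$ by the construction described below. If $F$ is a component of $T-T_S$, then $F$ has either one or two neighbours in $T_S$.
   Context: Construction. A split vertex of a tree $\Gamma$ on $t$ vertices is a vertex $x$ such that the vertices of $\Gamma-x$ can be grouped into two forests $\Gamma_1,\Gamma_2$ with $t/3\le v(\Gamma_1),v(\Gamma_2)\le 2t/3$ and no edge between them in $\Gamma-x$. Starting from $T$, repeatedly remove a split vertex from each current subtree with more than $\eta n$ vertices, until every remaining subtree has at most $\eta n$ vertices. Let $T'$ be the smallest subtree of $T$ containing all removed split vertices. Mark the split vertices and all vertices with at least $3$ neighbours in $T'$. A line in $T'$ is a path all of whose inner vertices have degree two in $T'$ and are unmarked; a maximal line is long if its length is at least $10$. The skeleton $T_S$ is obtained from $T'$ by deleting the inner vertices of all long maximal lines.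
   Formalization: The parameter η is rational rather than real. -}

module Defs where

open import Data.Bool using (Bool; true; false; _∧_)
open import Data.Nat using (ℕ; zero; suc; _≤_; _*_)
open import Data.Fin using (Fin)
open import Data.Fin.Subset using (Subset; _∈_; _∉_; _⊆_; ∁; _∩_; ∣_∣) renaming (⊥ to ∅)
open import Data.Vec using (tabulate)
open import Data.List using (List; []; _∷_; _++_; [_]; length; allFin)
open import Data.Bool.ListAction using (any)
open import Data.List.Relation.Unary.All using (All)
open import Data.List.Relation.Unary.Unique.Propositional using (Unique)
open import Data.Integer using (+_)
open import Data.Rational using (ℚ; _/_) renaming (_<_ to _<ℚ_; _*_ to _*ℚ_)
open import Data.Product using (Σ; ∃; _×_; _,_)
open import Data.Sum using (_⊎_)
open import Data.Empty using (⊥)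
open import Relation.Nullary using (¬_)
open import Relation.Binary.PropositionalEquality using (_≡_; _≢_)

Graph : ℕ → Set
Graph n = Fin n → Fin n → Bool

module _ {n : ℕ} (G : Graph n) where

  Adj : Fin n → Fin n → Set
  Adj u v = G u v ≡ true

  Chain : List (Fin n) → Set
  Chain []           = Data.Unit.⊤ where import Data.Unit
  Chain (x ∷ [])     = Data.Unit.⊤ where import Data.Unit
  Chain (x ∷ y ∷ xs) = Adj x y × Chain (y ∷ xs)

  IsCycle : List (Fin n) → Set
  IsCycle []       = ⊥
  IsCycle (x ∷ xs) = (3 ≤ length (x ∷ xs)) × Unique (x ∷ xs) × Chain (x ∷ xs ++ [ x ])

  data Walk (C : Subset n) : Fin n → Fin n → Set where
    here : ∀ {u} → u ∈ C → Walk C u u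
    step : ∀ {u w v} → u ∈ C → Adj u w → Walk C w v → Walk C u v

  Connected : Subset n → Set
  Connected C = ∀ u v → u ∈ C → v ∈ C → Walk C u v

  record IsTree : Set where
    field
      symmetric  : ∀ u v → G u v ≡ G v u
      irreflexive : ∀ v → G v v ≡ false
      connected  : ∀ u v → Walk Data.Fin.Subset.⊤ u v
      acyclic    : ∀ xs → ¬ IsCycle xs

  nbhd : Fin n → Subset n
  nbhd v = tabulate (G v)

  deg : Fin n → ℕ
  deg v = ∣ nbhd v ∣

  degIn : Subset n → Fin n → ℕ
  degIn S v = ∣ nbhd v ∩ S ∣

  MaxDegree≤ : ℕ → Set
  MaxDegree≤ D = ∀ v → deg v ≤ D

  nbrSet : Subset n → Subset n
  nbrSet F = tabulate (λ v → any (λ u → Data.Vec.lookup F u ∧ G u v) (allFin n))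
    where import Data.Vec

  record IsComponent (S C : Subset n) : Set where
    field
      sub       : C ⊆ S
      nonempty  : ∃ λ v → v ∈ C
      connected : Connected C
      closed    : ∀ u v → u ∈ C → v ∈ S → Adj u v → v ∈ C

  Split : Subset n → Fin n → Set
  Split C x = x ∈ C × Σ (Subset n) λ A → Σ (Subset n) λ B →
      A ⊆ C × B ⊆ C × x ∉ A × x ∉ B
    × (∀ v → v ∈ A → v ∉ B)
    × (∀ v → v ∈ C → v ≢ x → v ∈ A ⊎ v ∈ B)
    × (∀ u v → u ∈ A → v ∈ B → G u v ≡ false)
    × ∣ C ∣ ≤ 3 * ∣ A ∣ × 3 * ∣ A ∣ ≤ 2 * ∣ C ∣
    × ∣ C ∣ ≤ 3 * ∣ B ∣ × 3 * ∣ B ∣ ≤ 2 * ∣ C ∣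

  module _ (η : ℚ) where

    Big : Subset n → Set
    Big C = (η *ℚ (+ n / 1)) <ℚ (+ ∣ C ∣ / 1)

    -- one round: from each current subtree (component of T - R) with more than η n
    -- vertices exactly one split vertex is removed; other subtrees are untouched
    Round : Subset n → Subset n → Set
    Round R R' = R ⊆ R' × (∀ C → IsComponent (∁ R) C →
        (Big C → Σ (Fin n) λ x → x ∈ R' × Split C x × (∀ y → y ∈ C → y ∈ R' → y ≡ x))
      × (¬ Big C → ∀ y → y ∈ C → y ∉ R'))

    data Reach : Subset n → Set where
      start : Reach ∅
      round : ∀ {R R'} → Reach R → Round R R' → Reach R'

    Final : Subset n → Set
    Final R = ∀ C → IsComponent (∁ R) C → ¬ Big C

  SmallestSubtree : Subset n → Subset n → Set
  SmallestSubtree R T' = R ⊆ T' × Connected T' × (∀ S → R ⊆ S → Connected S → T' ⊆ S)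

  module _ (R T' : Subset n) where

    Marked : Fin n → Set
    Marked v = v ∈ R ⊎ 3 ≤ degIn T' v

    Inner : Fin n → List (Fin n) → Set
    Inner v ps = Σ (List (Fin n)) λ as → Σ (List (Fin n)) λ bs →
      ps ≡ as ++ [ v ] ++ bs × as ≢ [] × bs ≢ []

    Infix : List (Fin n) → List (Fin n) → Set
    Infix ps qs = Σ (List (Fin n)) λ as → Σ (List (Fin n)) λ bs → qs ≡ as ++ ps ++ bs

    Line : List (Fin n) → Set
    Line ps = Unique ps × Chain ps × All (_∈ T') ps
      × (∀ v → Inner v ps → degIn T' v ≡ 2 × ¬ Marked v)

    MaximalLine : List (Fin n) → Set
    MaximalLine ps = Line ps × (∀ qs → Line qs → Infix ps qs → length qs ≡ length ps)

    -- long: length (number of edges) at least 10, i.e. at least 11 vertices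
    LongMaximalLine : List (Fin n) → Set
    LongMaximalLine ps = MaximalLine ps × 11 ≤ length ps

    IsSkeleton : Subset n → Set
    IsSkeleton TS = ∀ v →
      (v ∈ TS → v ∈ T' × ¬ (Σ (List (Fin n)) λ ps → LongMaximalLine ps × Inner v ps))
      × (v ∈ T' × ¬ (Σ (List (Fin n)) λ ps → LongMaximalLine ps × Inner v ps) → v ∈ TS)

-- Since the procedure stopped and η < 1, some vertex r was removed; r is marked, so r ∈ T_S, and
-- as T is connected, F has at least one neighbour in T_S. The upper bound rests on one tree fact:
-- a walk that leaves a connected set S along an edge x y and stays outside S can only return to
-- S at x. If F misses T', all of F lies outside T' and any two T_S-neighbours of F coincide.
-- Otherwise F contains an inner vertex of a long maximal line a … b. Its endpoints lie in T_S,
-- because an endpoint of degree 2 in T' that is unmarked would extend the line, contradicting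
-- maximality. The inner vertices have degree 2 in T', so their T'-neighbours lie on the line;
-- everything F reaches off T' returns to T' only at the line. Hence F's neighbours in T_S are
-- among a and b.

module Submission where

open import Defs
open import Data.Bool using (Bool; true)
open import Data.Bool.Properties using (T-≡; T-∧)
open import Data.Empty using (⊥; ⊥-elim)
open import Data.Fin using (Fin; zero; _≟_)
open import Data.Fin.Properties using (any?)
open import Data.Fin.Subset using (Subset; inside; outside; _∈_; _∉_; _⊆_; ∁; _∩_; _∪_; _-_; ⁅_⁆; ∣_∣; Nonempty)
open import Data.Fin.Subset.Properties
  using ( x∈p∩q⁺; x∈p∩q⁻; x∈p∪q⁺; x∈⁅x⁆; x∈⁅y⁆⇒x≡y; ∣⁅x⁆∣≡1; p⊆q⇒∣p∣≤∣q∣; x∈p⇒∣p-x∣<∣p∣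
        ; x∈p∧x≢y⇒x∈p-y; x∈∁p⇒x∉p; x∉p⇒x∈∁p; x∈p⇒x∉∁p; x∉∁p⇒x∈p
        ; nonempty?; Empty-unique; ∣∁p∣≡n∸∣p∣; ∣⊥∣≡0; _∈?_ )
open import Data.Integer using (+_)
open import Data.List using (List; []; _∷_; _++_; [_]; length; reverse; reverseAcc; allFin; initLast; _∷ʳ′_)
open import Data.List.Properties
  using ( ++-assoc; ++-identityʳ; ++-conicalʳ; length-++; length-reverse
        ; reverse-++; reverse-involutive; reverse-injective )
open import Data.List.Membership.Propositional using (lose) renaming (_∈_ to _∈ₗ_; _∉_ to _∉ₗ_)
open import Data.List.Membership.Propositional.Properties using (∈-∃++; ∈-++⁺ˡ; ∈-++⁺ʳ; ∈-++⁻; ∈-allFin)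
open import Data.List.Relation.Binary.Permutation.Propositional using (↭⇒↭ₛ; ↭-sym)
open import Data.List.Relation.Binary.Permutation.Propositional.Properties using (↭-reverse; All-resp-↭)
import Data.List.Relation.Binary.Permutation.Setoid.Properties as Permₛ
open import Data.List.Relation.Unary.All as All using (All; []; _∷_)
import Data.List.Relation.Unary.All.Properties as Allₚ
open import Data.List.Relation.Unary.AllPairs using ([]; _∷_)
open import Data.List.Relation.Unary.Any using (here; there; satisfied)
open import Data.List.Relation.Unary.Any.Properties using (any⁺; any⁻)
open import Data.List.Relation.Unary.Unique.Propositional using (Unique)
import Data.List.Relation.Unary.Unique.Propositional.Properties as Uniqueₚ
open import Data.Nat using (ℕ; suc; _+_; _∸_; _≤_; _≤?_; z≤n; s≤s)
open import Data.Nat.Properties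
  using (≤-refl; ≤-trans; ≤-reflexive; +-suc; +-mono-≤; n≤1+n; 1+n≰n; 1+n≢n; m≤n+m)
open import Data.Product using (∃; ∃₂; _×_; _,_; proj₁; proj₂)
open import Data.Rational using (ℚ; 0ℚ; 1ℚ; _<_; _*_; _/_; Positive)
open import Data.Rational.Properties using (*-monoˡ-<-pos; *-identityˡ; normalize-pos)
open import Data.Sum using (_⊎_; inj₁; inj₂)
open import Data.Unit using (tt)
open import Data.Vec using (tabulate; lookup; []; _∷_)
open import Data.Vec.Properties using (lookup∘tabulate; []=⇒lookup; lookup⇒[]=)
open import Function.Bundles using (Equivalence)
open import Relation.Nullary using (¬_; yes; no)
open import Relation.Nullary.Decidable using (_×-dec_; ¬?; decidable-stable)
open import Relation.Binary.PropositionalEquality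
  using (_≡_; _≢_; refl; sym; trans; cong; cong₂; subst; setoid; module ≡-Reasoning)

open Equivalence using (to; from)

∣p∪q∣≤∣p∣+∣q∣ : ∀ {n} (p q : Subset n) → ∣ p ∪ q ∣ ≤ ∣ p ∣ + ∣ q ∣
∣p∪q∣≤∣p∣+∣q∣ []            []            = z≤n
∣p∪q∣≤∣p∣+∣q∣ (outside ∷ p) (outside ∷ q) = ∣p∪q∣≤∣p∣+∣q∣ p q
∣p∪q∣≤∣p∣+∣q∣ (outside ∷ p) (inside  ∷ q) =
  ≤-trans (s≤s (∣p∪q∣≤∣p∣+∣q∣ p q)) (≤-reflexive (sym (+-suc ∣ p ∣ ∣ q ∣)))
∣p∪q∣≤∣p∣+∣q∣ (inside  ∷ p) (outside ∷ q) = s≤s (∣p∪q∣≤∣p∣+∣q∣ p q)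
∣p∪q∣≤∣p∣+∣q∣ (inside  ∷ p) (inside  ∷ q) =
  s≤s (≤-trans (∣p∪q∣≤∣p∣+∣q∣ p q) (+-mono-≤ {∣ p ∣} ≤-refl (n≤1+n ∣ q ∣)))

1≤k≤2⇒k≡1⊎k≡2 : ∀ {k} → 1 ≤ k → k ≤ 2 → k ≡ 1 ⊎ k ≡ 2
1≤k≤2⇒k≡1⊎k≡2 {1}                   _ _                = inj₁ refl
1≤k≤2⇒k≡1⊎k≡2 {2}                   _ _                = inj₂ refl
1≤k≤2⇒k≡1⊎k≡2 {suc (suc (suc _))}   _ (s≤s (s≤s ()))

q<1⇒q*r<r : ∀ {q} r .{{_ : Positive r}} → q < 1ℚ → q * r < r
q<1⇒q*r<r {q} r q<1 = subst (q * r <_) (*-identityˡ r) (*-monoˡ-<-pos r q<1)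

x∈p⇒1≤∣p∣ : ∀ {n} {p : Subset n} {x} → x ∈ p → 1 ≤ ∣ p ∣
x∈p⇒1≤∣p∣ {p = p} {x} x∈p = subst (_≤ ∣ p ∣) (∣⁅x⁆∣≡1 x) (p⊆q⇒∣p∣≤∣q∣ ⁅x⁆⊆p)
  where
  ⁅x⁆⊆p : ⁅ x ⁆ ⊆ p
  ⁅x⁆⊆p y∈⁅x⁆ = subst (_∈ p) (sym (x∈⁅y⁆⇒x≡y x y∈⁅x⁆)) x∈p

module _ {n : ℕ} {p : Subset n} where

  ⊆⁅x,y⁆⇒∣p∣≤2 : ∀ {x y} → (∀ {z} → z ∈ p → z ≡ x ⊎ z ≡ y) → ∣ p ∣ ≤ 2
  ⊆⁅x,y⁆⇒∣p∣≤2 {x} {y} p⊆ = ≤-trans (p⊆q⇒∣p∣≤∣q∣ p⊆⁅x⁆∪⁅y⁆) ∣⁅x⁆∪⁅y⁆∣≤2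
    where
    p⊆⁅x⁆∪⁅y⁆ : p ⊆ ⁅ x ⁆ ∪ ⁅ y ⁆
    p⊆⁅x⁆∪⁅y⁆ z∈p with p⊆ z∈p
    ... | inj₁ refl = x∈p∪q⁺ (inj₁ (x∈⁅x⁆ x))
    ... | inj₂ refl = x∈p∪q⁺ (inj₂ (x∈⁅x⁆ y))
    ∣⁅x⁆∪⁅y⁆∣≤2 : ∣ ⁅ x ⁆ ∪ ⁅ y ⁆ ∣ ≤ 2
    ∣⁅x⁆∪⁅y⁆∣≤2 = subst (∣ ⁅ x ⁆ ∪ ⁅ y ⁆ ∣ ≤_) (cong₂ _+_ (∣⁅x⁆∣≡1 x) (∣⁅x⁆∣≡1 y)) (∣p∪q∣≤∣p∣+∣q∣ ⁅ x ⁆ ⁅ y ⁆)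

  ∣p∣≤2⇒⊆⁅x,y⁆ : ∀ {x y z} → ∣ p ∣ ≤ 2 → x ∈ p → y ∈ p → x ≢ y → z ∈ p → z ≡ x ⊎ z ≡ y
  ∣p∣≤2⇒⊆⁅x,y⁆ {x} {y} {z} ∣p∣≤2 x∈p y∈p x≢y z∈p with z ≟ x | z ≟ y
  ... | yes z≡x | _       = inj₁ z≡x
  ... | no _    | yes z≡y = inj₂ z≡y
  ... | no z≢x  | no z≢y  = ⊥-elim (1+n≰n (≤-trans 3≤∣p∣ ∣p∣≤2))
    where
    y∈p-x : y ∈ p - x
    y∈p-x = x∈p∧x≢y⇒x∈p-y y∈p (λ y≡x → x≢y (sym y≡x))
    z∈p-x-y : z ∈ p - x - y
    z∈p-x-y = x∈p∧x≢y⇒x∈p-y (x∈p∧x≢y⇒x∈p-y z∈p z≢x) z≢y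
    3≤∣p∣ : 3 ≤ ∣ p ∣
    3≤∣p∣ = ≤-trans (s≤s (≤-trans (s≤s (x∈p⇒1≤∣p∣ z∈p-x-y)) (x∈p⇒∣p-x∣<∣p∣ y∈p-x)))
                    (x∈p⇒∣p-x∣<∣p∣ x∈p)

  2≤∣p∣⇒∃≢ : ∀ {x} → 2 ≤ ∣ p ∣ → x ∈ p → ∃ λ y → y ∈ p × y ≢ x
  2≤∣p∣⇒∃≢ {x} 2≤∣p∣ x∈p with any? (λ y → (y ∈? p) ×-dec ¬? (y ≟ x))
  ... | yes (y , y∈p , y≢x) = y , y∈p , y≢x
  ... | no ∄y = ⊥-elim (1+n≰n (≤-trans 2≤∣p∣ ∣p∣≤1))
    where
    p⊆⁅x⁆ : p ⊆ ⁅ x ⁆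
    p⊆⁅x⁆ {y} y∈p with y ≟ x
    ... | yes refl = x∈⁅x⁆ x
    ... | no y≢x   = ⊥-elim (∄y (y , y∈p , y≢x))
    ∣p∣≤1 : ∣ p ∣ ≤ 1
    ∣p∣≤1 = subst (∣ p ∣ ≤_) (∣⁅x⁆∣≡1 x) (p⊆q⇒∣p∣≤∣q∣ p⊆⁅x⁆)

∈-tabulate⁺ : ∀ {n} (f : Fin n → Bool) {v} → f v ≡ true → v ∈ tabulate f
∈-tabulate⁺ f {v} fv = lookup⇒[]= v (tabulate f) (trans (lookup∘tabulate f v) fv)

∈-tabulate⁻ : ∀ {n} (f : Fin n → Bool) {v} → v ∈ tabulate f → f v ≡ true
∈-tabulate⁻ f {v} v∈ = trans (sym (lookup∘tabulate f v)) ([]=⇒lookup v∈)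

unique-++⁻ˡ : ∀ {A : Set} (xs : List A) {ys} → Unique (xs ++ ys) → Unique xs
unique-++⁻ˡ []       _                = []
unique-++⁻ˡ (x ∷ xs) (x∉xs++ys ∷ uniq) = Allₚ.++⁻ˡ xs x∉xs++ys ∷ unique-++⁻ˡ xs uniq

unique-++⁻ʳ : ∀ {A : Set} (xs : List A) {ys} → Unique (xs ++ ys) → Unique ys
unique-++⁻ʳ []       uniq       = uniq
unique-++⁻ʳ (x ∷ xs) (_ ∷ uniq) = unique-++⁻ʳ xs uniq

unique-reverse : ∀ {A : Set} (xs : List A) → Unique xs → Unique (reverse xs)
unique-reverse {A} xs = Permₛ.Unique-resp-↭ (setoid A) (↭⇒↭ₛ (↭-sym (↭-reverse xs)))

all-reverse : ∀ {A : Set} {P : A → Set} (xs : List A) → All P xs → All P (reverse xs)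
all-reverse xs = All-resp-↭ (↭-sym (↭-reverse xs))

reverse-≢[] : ∀ {A : Set} {xs : List A} → xs ≢ [] → reverse xs ≢ []
reverse-≢[] xs≢[] rev≡[] = xs≢[] (reverse-injective rev≡[])

reverse-++-++ : ∀ {A : Set} (as xs bs : List A) → reverse (as ++ xs ++ bs) ≡ reverse bs ++ reverse xs ++ reverse as
reverse-++-++ as xs bs = begin
  reverse (as ++ xs ++ bs)                  ≡⟨ reverse-++ as (xs ++ bs) ⟩
  reverse (xs ++ bs) ++ reverse as          ≡⟨ cong (_++ reverse as) (reverse-++ xs bs) ⟩
  (reverse bs ++ reverse xs) ++ reverse as  ≡⟨ ++-assoc (reverse bs) (reverse xs) (reverse as) ⟩
  reverse bs ++ reverse xs ++ reverse as    ∎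
  where open ≡-Reasoning

∈-sandwich⁻ : ∀ {A : Set} {w a b : A} {mid} → w ∈ₗ a ∷ mid ++ [ b ] → w ≡ a ⊎ w ∈ₗ mid ⊎ w ≡ b
∈-sandwich⁻ (here w≡a) = inj₁ w≡a
∈-sandwich⁻ {mid = mid} (there w∈) with ∈-++⁻ mid w∈
... | inj₁ w∈mid        = inj₂ (inj₁ w∈mid)
... | inj₂ (here w≡b)   = inj₂ (inj₂ w≡b)

last : ∀ {A : Set} → A → List A → A
last u []       = u
last u (x ∷ xs) = last x xs

last-++-∷ : ∀ {A : Set} (w : A) xs u ys → last w (xs ++ u ∷ ys) ≡ last u ys
last-++-∷ w []       u ys = refl
last-++-∷ w (x ∷ xs) u ys = last-++-∷ x xs u ys

last-∷-≡ : ∀ {A : Set} {w : A} {xs} pre {u} post → w ∷ xs ≡ pre ++ u ∷ post → last w xs ≡ last u post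
last-∷-≡ []        post refl = refl
last-∷-≡ (x ∷ pre) post refl = last-++-∷ x pre _ post

module _ {n : ℕ} (G : Graph n) where

  ∈-nbhd⁺ : ∀ {u w} → Adj G u w → w ∈ nbhd G u
  ∈-nbhd⁺ = ∈-tabulate⁺ _

  ∈-nbhd⁻ : ∀ {u w} → w ∈ nbhd G u → Adj G u w
  ∈-nbhd⁻ = ∈-tabulate⁻ _

  ∈-nbrSet⁺ : ∀ {F u v} → u ∈ F → Adj G u v → v ∈ nbrSet G F
  ∈-nbrSet⁺ {F} {u} {v} u∈F u~v =
    ∈-tabulate⁺ _ (T-≡ .to (any⁺ _ (lose (∈-allFin u) (T-∧ .from (T-≡ .from F[u] , T-≡ .from u~v)))))
    where
    F[u] : lookup F u ≡ true
    F[u] = []=⇒lookup u∈F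

  ∈-nbrSet⁻ : ∀ {F v} → v ∈ nbrSet G F → ∃ λ u → u ∈ F × Adj G u v
  ∈-nbrSet⁻ {F} {v} v∈ with satisfied (any⁻ _ (allFin n) (T-≡ .from (∈-tabulate⁻ _ v∈)))
  ... | u , Fu∧u~v with T-∧ .to Fu∧u~v
  ...   | Fu , u~v = u , lookup⇒[]= u F (T-≡ .to Fu) , T-≡ .to u~v

  chain-++ : ∀ u xs z ys → Chain G (u ∷ xs) → Adj G (last u xs) z → Chain G (z ∷ ys)
           → Chain G (u ∷ xs ++ z ∷ ys)
  chain-++ u []       z ys _            u~z chain = u~z , chain
  chain-++ u (x ∷ xs) z ys (u~x , chain) x~z chain′ = u~x , chain-++ x xs z ys chain x~z chain′

  chain-++⁻ˡ : ∀ xs {ys} → Chain G (xs ++ ys) → Chain G xs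
  chain-++⁻ˡ []           _             = tt
  chain-++⁻ˡ (x ∷ [])     _             = tt
  chain-++⁻ˡ (x ∷ y ∷ xs) (x~y , chain) = x~y , chain-++⁻ˡ (y ∷ xs) chain

  chain-++⁻ʳ : ∀ xs {ys} → Chain G (xs ++ ys) → Chain G ys
  chain-++⁻ʳ []           chain         = chain
  chain-++⁻ʳ (x ∷ [])     {[]}    _     = tt
  chain-++⁻ʳ (x ∷ [])     {_ ∷ _} chain = proj₂ chain
  chain-++⁻ʳ (x ∷ y ∷ xs) chain         = chain-++⁻ʳ (y ∷ xs) (proj₂ chain)

  chain-reverse : (∀ {u v} → Adj G u v → Adj G v u) → ∀ xs → Chain G xs → Chain G (reverse xs)
  chain-reverse adj-sym []       _     = tt
  chain-reverse adj-sym (x ∷ xs) chain = go x [] xs tt chain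
    where
    go : ∀ x acc xs → Chain G (x ∷ acc) → Chain G (x ∷ xs) → Chain G (reverseAcc (x ∷ acc) xs)
    go x acc []       done _            = done
    go x acc (y ∷ xs) done (x~y , todo) = go y (x ∷ acc) xs (adj-sym x~y , done) todo

  inner-neighbours : ∀ as u bs → Unique (as ++ u ∷ bs) → Chain G (as ++ u ∷ bs) → as ≢ [] → bs ≢ []
    → ∃₂ λ x y → x ∈ₗ as ++ u ∷ bs × y ∈ₗ as ++ u ∷ bs × x ≢ y × Adj G x u × Adj G u y
  inner-neighbours []       u bs _ _ as≢[] _ = ⊥-elim (as≢[] refl)
  inner-neighbours (x ∷ []) u [] _ _ _ bs≢[] = ⊥-elim (bs≢[] refl)
  inner-neighbours (x ∷ []) u (y ∷ bs) ((_ ∷ x≢y ∷ _) ∷ _) (x~u , u~y , _) _ _ =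
    x , y , here refl , there (there (here refl)) , x≢y , x~u , u~y
  inner-neighbours (x ∷ x′ ∷ as) u bs (_ ∷ uniq) (_ , chain) _ bs≢[]
    with inner-neighbours (x′ ∷ as) u bs uniq chain (λ ()) bs≢[]
  ... | y , z , y∈ , z∈ , rest = y , z , there y∈ , there z∈ , rest

  walk-head : ∀ {C u v} → Walk G C u v → u ∈ C
  walk-head (here u∈C)     = u∈C
  walk-head (step u∈C _ _) = u∈C

  walk-mono : ∀ {C D u v} → C ⊆ D → Walk G C u v → Walk G D u v
  walk-mono C⊆D (here u∈C)       = here (C⊆D u∈C)
  walk-mono C⊆D (step u∈C u~w W) = step (C⊆D u∈C) u~w (walk-mono C⊆D W)

  walk-∷ʳ : ∀ {C u v w} → Walk G C u v → Adj G v w → w ∈ C → Walk G C u w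
  walk-∷ʳ (here u∈C)       u~w w∈C = step u∈C u~w (here w∈C)
  walk-∷ʳ (step u∈C u~x W) v~w w∈C = step u∈C u~x (walk-∷ʳ W v~w w∈C)

  record Path (C : Subset n) (u v : Fin n) : Set where
    field
      tail   : List (Fin n)
      unique : Unique (u ∷ tail)
      chain  : Chain G (u ∷ tail)
      within : All (_∈ C) (u ∷ tail)
      ends   : last u tail ≡ v

  open import Data.List.Membership.DecPropositional (_≟_ {n}) using () renaming (_∈?_ to _∈ₗ?_)

  path-∷ : ∀ {C u w v} → u ∈ C → Adj G u w → Path C w v → Path C u v
  path-∷ {C} {u} {w} u∈C u~w P with u ∈ₗ? w ∷ Path.tail P
  ... | no u∉P = record
    { tail   = w ∷ tail
    ; unique = Allₚ.¬Any⇒All¬ (w ∷ tail) u∉P ∷ unique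
    ; chain  = u~w , chain
    ; within = u∈C ∷ within
    ; ends   = ends
    }
    where open Path P
  ... | yes u∈P with ∈-∃++ u∈P
  ...   | pre , post , P≡pre++u∷post = record
    { tail   = post
    ; unique = unique-++⁻ʳ pre (subst Unique P≡pre++u∷post unique)
    ; chain  = chain-++⁻ʳ pre (subst (Chain G) P≡pre++u∷post chain)
    ; within = Allₚ.++⁻ʳ pre (subst (All (_∈ C)) P≡pre++u∷post within)
    ; ends   = trans (sym (last-∷-≡ pre post P≡pre++u∷post)) ends
    }
    where open Path P

  walk⇒path : ∀ {C u v} → Walk G C u v → Path C u v
  walk⇒path (here u∈C)       = record
    { tail = [] ; unique = [] ∷ [] ; chain = tt ; within = u∈C ∷ [] ; ends = refl }
  walk⇒path (step u∈C u~w W) = path-∷ u∈C u~w (walk⇒path W)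

module Tree {n : ℕ} {G : Graph n} (tree : IsTree G) where

  open IsTree tree

  adj-sym : ∀ {u v} → Adj G u v → Adj G v u
  adj-sym {u} {v} u~v = trans (symmetric v u) u~v

  adj-irrefl : ∀ {u} → ¬ Adj G u u
  adj-irrefl {u} u~u with trans (sym u~u) (irreflexive u)
  ... | ()

  no-closing-edge : ∀ {a xs} → Unique (a ∷ xs) → Chain G (a ∷ xs) → 2 ≤ length xs
                  → ¬ Adj G (last a xs) a
  no-closing-edge {a} {xs} uniq chain 2≤∣xs∣ last~a =
    acyclic (a ∷ xs) (s≤s 2≤∣xs∣ , uniq , chain-++ G a xs a [] chain last~a tt)

  neighbour∉path : ∀ {a p c} zs → Unique (a ∷ p ∷ zs) → Chain G (a ∷ p ∷ zs) → Adj G a c → c ≢ p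
                 → c ∉ₗ a ∷ p ∷ zs
  neighbour∉path zs _ _ a~c _   (here refl)         = adj-irrefl a~c
  neighbour∉path zs _ _ _   c≢p (there (here refl)) = c≢p refl
  neighbour∉path {a} {p} {c} zs uniq chain a~c _ (there (there c∈zs)) with ∈-∃++ c∈zs
  ... | z₁ , z₂ , refl =
    no-closing-edge (unique-++⁻ˡ (a ∷ cycle) (subst Unique split uniq))
                    (chain-++⁻ˡ G (a ∷ cycle) (subst (Chain G) split chain))
                    2≤∣cycle∣
                    (subst (λ x → Adj G x a) (sym (last-++-∷ a (p ∷ z₁) c [])) (adj-sym a~c))
    where
    cycle : List (Fin n)
    cycle = p ∷ z₁ ++ [ c ]
    split : a ∷ p ∷ z₁ ++ [ c ] ++ z₂ ≡ (a ∷ cycle) ++ z₂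
    split = cong (λ t → a ∷ p ∷ t) (sym (++-assoc z₁ [ c ] z₂))
    2≤∣cycle∣ : 2 ≤ length cycle
    2≤∣cycle∣ = s≤s (subst (1 ≤_) (sym (length-++ z₁)) (m≤n+m 1 (length z₁)))

  detour-returns : ∀ {S} → Connected G S → ∀ {x y y′ z} → x ∈ S → z ∈ S
                 → Adj G x y → Walk G (∁ S) y y′ → Adj G y′ z → x ≡ z
  detour-returns {S} S-conn {x} {y} {y′} {z} x∈S z∈S x~y W y′~z
    with x ≟ z | walk⇒path G W | walk⇒path G (S-conn z x z∈S x∈S)
  ... | yes x≡z | _ | _ = x≡z
  ... | no x≢z  | _ | record { tail = [] ; ends = z≡x } = ⊥-elim (x≢z (sym z≡x))
  ... | no _    | record { tail = ys ; unique = uP ; chain = cP ; within = wP ; ends = eP }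
                | record { tail = z′ ∷ zs ; unique = uQ ; chain = cQ ; within = wQ ; ends = eQ } =
    ⊥-elim (no-closing-edge unique chain 2≤∣cycle∣ last~y)
    where
    cycle : List (Fin n)
    cycle = ys ++ z ∷ z′ ∷ zs
    unique : Unique (y ∷ cycle)
    unique = Uniqueₚ.++⁺ uP uQ λ (v∈P , v∈Q) → x∈∁p⇒x∉p (All.lookup wP v∈P) (All.lookup wQ v∈Q)
    chain : Chain G (y ∷ cycle)
    chain = chain-++ G y ys z (z′ ∷ zs) cP (subst (λ t → Adj G t z) (sym eP) y′~z) cQ
    2≤∣cycle∣ : 2 ≤ length cycle
    2≤∣cycle∣ = subst (2 ≤_) (sym (length-++ ys))
                      (≤-trans (s≤s (s≤s z≤n)) (m≤n+m (length (z ∷ z′ ∷ zs)) (length ys)))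
    last~y : Adj G (last y cycle) y
    last~y = subst (λ t → Adj G t y) (sym (trans (last-++-∷ y ys z (z′ ∷ zs)) eQ)) x~y

  module _ {S F : Subset n} (S-conn : Connected G S) {M : Fin n → Set}
           (M⊆S : ∀ {u} → M u → u ∈ S)
           (M-closed : ∀ {u w} → M u → w ∈ S → w ∈ F → Adj G u w → M w) where

    private
      -- Once a walk has left S along an edge x y with M x, it can re-enter S only at x.
      Reached : Fin n → Set
      Reached t = M t ⊎ ∃₂ λ x y → M x × Adj G x y × Walk G (∁ S) y t

      reached-step : ∀ {u w} → Reached u → w ∈ F → Adj G u w → Reached w
      reached-step {w = w} (inj₁ Mu) w∈F u~w with w ∈? S
      ... | yes w∈S = inj₁ (M-closed Mu w∈S w∈F u~w)
      ... | no  w∉S = inj₂ (_ , w , Mu , u~w , here (x∉p⇒x∈∁p w∉S))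
      reached-step {w = w} (inj₂ (x , y , Mx , x~y , W)) w∈F u~w with w ∈? S
      ... | yes w∈S = inj₁ (subst M (detour-returns S-conn (M⊆S Mx) w∈S x~y W u~w) Mx)
      ... | no  w∉S = inj₂ (x , y , Mx , x~y , walk-∷ʳ G W u~w (x∉p⇒x∈∁p w∉S))

      reached-walk : ∀ {u t} → Reached u → Walk G F u t → Reached t
      reached-walk r (here _)       = r
      reached-walk r (step _ u~w W) = reached-walk (reached-step r (walk-head G W) u~w) W

    reachable-S-neighbour : ∀ {u t w} → M u → Walk G F u t → w ∈ S → Adj G t w
                          → M w ⊎ ∃ λ x → M x × Adj G x w
    reachable-S-neighbour {t = t} Mu W w∈S t~w with reached-walk (inj₁ Mu) W
    ... | inj₁ Mt                     = inj₂ (t , Mt , t~w)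
    ... | inj₂ (x , y , Mx , x~y , W′) =
      inj₁ (subst M (detour-returns S-conn (M⊆S Mx) w∈S x~y W′ t~w) Mx)

module _ {n : ℕ} {G : Graph n} {S C : Subset n} (comp : IsComponent G S C) where

  open IsComponent comp

  component-exit : ∀ {D u t} → Walk G D u t → u ∈ C → t ∉ S → ∃ λ w → w ∈ nbrSet G C × w ∉ S
  component-exit (here _)               u∈C t∉S = ⊥-elim (t∉S (sub u∈C))
  component-exit (step {w = w} _ u~w W) u∈C t∉S with w ∈? S
  ... | yes w∈S = component-exit W (closed _ w u∈C w∈S u~w) t∉S
  ... | no  w∉S = w , ∈-nbrSet⁺ G u∈C u~w , w∉S

module Lines {n : ℕ} {G : Graph n} (tree : IsTree G) (R T' : Subset n) where

  open Tree tree

  inner-reverse : ∀ {v ps} → Inner G R T' v ps → Inner G R T' v (reverse ps)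
  inner-reverse {v} (as , bs , refl , as≢[] , bs≢[]) =
    reverse bs , reverse as , reverse-++-++ as [ v ] bs , reverse-≢[] bs≢[] , reverse-≢[] as≢[]

  infix-reverse : ∀ {ps qs} → Infix G R T' ps qs → Infix G R T' (reverse ps) (reverse qs)
  infix-reverse {ps} (as , bs , refl) = reverse bs , reverse as , reverse-++-++ as ps bs

  line-reverse : ∀ {ps} → Line G R T' ps → Line G R T' (reverse ps)
  line-reverse {ps} (uniq , chain , inT' , ok) =
    unique-reverse ps uniq , chain-reverse G adj-sym ps chain , all-reverse ps inT' ,
    λ v inner → ok v (subst (Inner G R T' v) (reverse-involutive ps) (inner-reverse inner))

  maximalLine-reverse : ∀ {ps} → MaximalLine G R T' ps → MaximalLine G R T' (reverse ps)
  maximalLine-reverse {ps} (line , maximal) = line-reverse line , maximal′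
    where
    open ≡-Reasoning
    maximal′ : ∀ qs → Line G R T' qs → Infix G R T' (reverse ps) qs → length qs ≡ length (reverse ps)
    maximal′ qs line-qs ps⊑qs = begin
      length qs            ≡⟨ length-reverse qs ⟨
      length (reverse qs)  ≡⟨ maximal (reverse qs) (line-reverse line-qs) ps⊑rev-qs ⟩
      length ps            ≡⟨ length-reverse ps ⟨
      length (reverse ps)  ∎
      where
      ps⊑rev-qs : Infix G R T' ps (reverse qs)
      ps⊑rev-qs = subst (λ xs → Infix G R T' xs (reverse qs)) (reverse-involutive ps) (infix-reverse ps⊑qs)

  longMaximalLine-reverse : ∀ {ps} → LongMaximalLine G R T' ps → LongMaximalLine G R T' (reverse ps)
  longMaximalLine-reverse {ps} (maximal , long) =
    maximalLine-reverse maximal , subst (11 ≤_) (sym (length-reverse ps)) long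

  inner-∷ : ∀ {v c x xs} → Inner G R T' v (c ∷ x ∷ xs) → v ≡ x ⊎ Inner G R T' v (x ∷ xs)
  inner-∷ ([]         , _  , _    , as≢[] , _)     = ⊥-elim (as≢[] refl)
  inner-∷ (_ ∷ []     , _  , refl , _     , _)     = inj₁ refl
  inner-∷ (_ ∷ a ∷ as , bs , refl , _     , bs≢[]) = inj₂ (a ∷ as , bs , refl , (λ ()) , bs≢[])

  line-∷ : ∀ {a p c zs} → Line G R T' (a ∷ p ∷ zs) → c ∈ T' → Adj G a c → c ≢ p
         → degIn G T' a ≡ 2 → ¬ Marked G R T' a → Line G R T' (c ∷ a ∷ p ∷ zs)
  line-∷ {a} {p} {c} {zs} (uniq , chain , inT' , ok) c∈T' a~c c≢p deg2 unmarked =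
    Allₚ.¬Any⇒All¬ {P = c ≡_} _ (neighbour∉path zs uniq chain a~c c≢p) ∷ uniq ,
    (adj-sym a~c , chain) , c∈T' ∷ inT' , ok′
    where
    ok′ : ∀ v → Inner G R T' v (c ∷ a ∷ p ∷ zs) → degIn G T' v ≡ 2 × ¬ Marked G R T' v
    ok′ v inner with inner-∷ inner
    ... | inj₁ refl   = deg2 , unmarked
    ... | inj₂ inner′ = ok v inner′

  maximalLine-head : ∀ {a p zs} → MaximalLine G R T' (a ∷ p ∷ zs) → degIn G T' a ≡ 2 → ¬ Marked G R T' a → ⊥
  maximalLine-head {a} {p} {zs} (line@(_ , (a~p , _) , (_ ∷ p∈T' ∷ _) , _) , maximal) deg2 unmarked
    with 2≤∣p∣⇒∃≢ (≤-reflexive (sym deg2)) (x∈p∩q⁺ (∈-nbhd⁺ G a~p , p∈T'))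
  ... | c , c∈S , c≢p with x∈p∩q⁻ (nbhd G a) T' c∈S
  ...   | c∈nbhd , c∈T' =
    1+n≢n (maximal (c ∷ a ∷ p ∷ zs) (line-∷ line c∈T' (∈-nbhd⁻ G c∈nbhd) c≢p deg2 unmarked)
                   ([ c ] , [] , cong (c ∷_) (sym (++-identityʳ _))))

  line-inner-neighbour : ∀ {ps u w} → Line G R T' ps → Inner G R T' u ps → w ∈ T' → Adj G u w → w ∈ₗ ps
  line-inner-neighbour {u = u} (uniq , chain , inT' , ok) inner@(as , bs , refl , as≢[] , bs≢[]) w∈T' u~w
    with inner-neighbours G as u bs uniq chain as≢[] bs≢[]
  ... | x , y , x∈ , y∈ , x≢y , x~u , u~y
    with ∣p∣≤2⇒⊆⁅x,y⁆ (≤-reflexive (proj₁ (ok u inner)))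
           (x∈p∩q⁺ (∈-nbhd⁺ G (adj-sym x~u) , All.lookup inT' x∈))
           (x∈p∩q⁺ (∈-nbhd⁺ G u~y , All.lookup inT' y∈))
           x≢y
           (x∈p∩q⁺ (∈-nbhd⁺ G u~w , w∈T'))
  ... | inj₁ refl = x∈
  ... | inj₂ refl = y∈

  inner⇒middle : ∀ {v ps} → Inner G R T' v ps
               → ∃₂ λ a b → ∃ λ mid → ps ≡ a ∷ mid ++ [ b ] × v ∈ₗ mid
  inner⇒middle ([]     , _  , _    , as≢[] , _)     = ⊥-elim (as≢[] refl)
  inner⇒middle {v} (a ∷ as , bs , refl , _ , bs≢[]) with initLast bs
  ... | []        = ⊥-elim (bs≢[] refl)
  ... | bs′ ∷ʳ′ b =
    a , b , as ++ v ∷ bs′ , cong (a ∷_) (sym (++-assoc as (v ∷ bs′) [ b ])) , ∈-++⁺ʳ as (here refl)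

  middle⇒inner : ∀ {a mid b u} → u ∈ₗ mid → Inner G R T' u (a ∷ mid ++ [ b ])
  middle⇒inner {a} {mid} {b} {u} u∈mid with ∈-∃++ u∈mid
  ... | m₁ , m₂ , refl =
    a ∷ m₁ , m₂ ++ [ b ] , cong (a ∷_) (++-assoc m₁ (u ∷ m₂) [ b ]) , (λ ()) , m₂∷ʳb≢[]
    where
    m₂∷ʳb≢[] : m₂ ++ [ b ] ≢ []
    m₂∷ʳb≢[] m₂∷ʳb≡[] with ++-conicalʳ m₂ [ b ] m₂∷ʳb≡[]
    ... | ()

module Skeleton {n : ℕ} {G : Graph n} (tree : IsTree G) {R T' TS : Subset n}
                (sk : IsSkeleton G R T' TS) where

  open Lines tree R T'

  TS⊆T' : TS ⊆ T'
  TS⊆T' {v} v∈TS = proj₁ (proj₁ (sk v) v∈TS)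

  inner∉TS : ∀ {u ps} → LongMaximalLine G R T' ps → Inner G R T' u ps → u ∉ TS
  inner∉TS {u} {ps} long inner u∈TS = proj₂ (proj₁ (sk u) u∈TS) (ps , long , inner)

  off-line⇒∈TS : ∀ {v} → v ∈ T' → (degIn G T' v ≡ 2 → ¬ Marked G R T' v → ⊥) → v ∈ TS
  off-line⇒∈TS {v} v∈T' off-line = proj₂ (sk v) (v∈T' , λ (_ , (((_ , _ , _ , inner-ok) , _) , _) , inner) →
    let deg2 , unmarked = inner-ok v inner in off-line deg2 unmarked)

  R⊆TS : R ⊆ T' → R ⊆ TS
  R⊆TS R⊆T' r∈R = off-line⇒∈TS (R⊆T' r∈R) (λ _ unmarked → unmarked (inj₁ r∈R))

  head∈TS : ∀ {a xs} → LongMaximalLine G R T' (a ∷ xs) → a ∈ TS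
  head∈TS {xs = []}    (_ , s≤s ())
  head∈TS {xs = _ ∷ _} (maximal@((_ , _ , a∈T' ∷ _ , _) , _) , _) =
    off-line⇒∈TS a∈T' (maximalLine-head maximal)

  ends∈TS : ∀ {a mid b} → LongMaximalLine G R T' (a ∷ mid ++ [ b ]) → a ∈ TS × b ∈ TS
  ends∈TS {a} {mid} {b} long = head∈TS long , head∈TS reversed
    where
    reversed : LongMaximalLine G R T' (b ∷ reverse mid ++ [ a ])
    reversed = subst (LongMaximalLine G R T') (reverse-++-++ [ a ] mid [ b ]) (longMaximalLine-reverse long)

module Attachments {n : ℕ} {G : Graph n} (tree : IsTree G) {R T' TS F : Subset n}
                   (T'-conn : Connected G T') (sk : IsSkeleton G R T' TS)
                   (comp : IsComponent G (∁ TS) F) where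

  open Tree tree
  open Lines tree R T'
  open Skeleton tree sk
  open IsComponent comp renaming (connected to F-conn)

  X : Subset n
  X = nbrSet G F ∩ TS

  ∈X⁻ : ∀ {x} → x ∈ X → ∃ λ u → u ∈ F × Adj G u x × x ∈ TS
  ∈X⁻ {x} x∈X with x∈p∩q⁻ (nbrSet G F) TS x∈X
  ... | x∈N[F] , x∈TS with ∈-nbrSet⁻ G x∈N[F]
  ...   | u , u∈F , u~x = u , u∈F , u~x , x∈TS

  F∉TS : ∀ {u} → u ∈ F → u ∉ TS
  F∉TS u∈F = x∈∁p⇒x∉p (sub u∈F)

  attachment-exists : ∀ {r} → r ∈ TS → ∃ λ x → x ∈ X
  attachment-exists {r} r∈TS with nonempty
  ... | f , f∈F with component-exit comp (IsTree.connected tree f r) f∈F (x∈p⇒x∉∁p r∈TS)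
  ...   | x , x∈N[F] , x∉∁TS = x , x∈p∩q⁺ (x∈N[F] , x∉∁p⇒x∈p x∉∁TS)

  off-T'-attachment-unique : (∀ {v} → v ∈ F → v ∉ T') → ∀ {x y} → x ∈ X → y ∈ X → x ≡ y
  off-T'-attachment-unique F∩T'≡∅ x∈X y∈X with ∈X⁻ x∈X | ∈X⁻ y∈X
  ... | u , u∈F , u~x , x∈TS | w , w∈F , w~y , y∈TS =
    detour-returns T'-conn (TS⊆T' x∈TS) (TS⊆T' y∈TS) (adj-sym u~x)
      (walk-mono G (λ v∈F → x∉p⇒x∈∁p (F∩T'≡∅ v∈F)) (F-conn u w u∈F w∈F)) w~y

  module _ {a mid b} (long : LongMaximalLine G R T' (a ∷ mid ++ [ b ])) where

    private
      line : Line G R T' (a ∷ mid ++ [ b ])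
      line = proj₁ (proj₁ long)

      mid∉TS : ∀ {w} → w ∈ₗ mid → w ∉ TS
      mid∉TS w∈mid = inner∉TS long (middle⇒inner w∈mid)

      mid⊆T' : ∀ {w} → w ∈ₗ mid → w ∈ T'
      mid⊆T' w∈mid = All.lookup (proj₁ (proj₂ (proj₂ line))) (there (∈-++⁺ˡ w∈mid))

      T'-neighbour-on-line : ∀ {u w} → u ∈ₗ mid → w ∈ T' → Adj G u w → w ∈ₗ a ∷ mid ++ [ b ]
      T'-neighbour-on-line u∈mid = line-inner-neighbour line (middle⇒inner u∈mid)

      on-line∩TS : ∀ {w} → w ∈ₗ a ∷ mid ++ [ b ] → w ∈ TS → w ≡ a ⊎ w ≡ b
      on-line∩TS w∈line w∈TS with ∈-sandwich⁻ w∈line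
      ... | inj₁ w≡a          = inj₁ w≡a
      ... | inj₂ (inj₁ w∈mid) = ⊥-elim (mid∉TS w∈mid w∈TS)
      ... | inj₂ (inj₂ w≡b)   = inj₂ w≡b

      mid-closed : ∀ {u w} → u ∈ₗ mid → w ∈ T' → w ∈ F → Adj G u w → w ∈ₗ mid
      mid-closed u∈mid w∈T' w∈F u~w with ∈-sandwich⁻ (T'-neighbour-on-line u∈mid w∈T' u~w)
      ... | inj₁ refl         = ⊥-elim (F∉TS w∈F (proj₁ (ends∈TS long)))
      ... | inj₂ (inj₁ w∈mid) = w∈mid
      ... | inj₂ (inj₂ refl)  = ⊥-elim (F∉TS w∈F (proj₂ (ends∈TS long)))

    line-attachments : ∀ {v} → v ∈ₗ mid → v ∈ F → ∀ {x} → x ∈ X → x ≡ a ⊎ x ≡ b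
    line-attachments {v} v∈mid v∈F x∈X with ∈X⁻ x∈X
    ... | u , u∈F , u~x , x∈TS
      with reachable-S-neighbour T'-conn mid⊆T' mid-closed v∈mid (F-conn v u v∈F u∈F) (TS⊆T' x∈TS) u~x
    ... | inj₁ x∈mid             = ⊥-elim (mid∉TS x∈mid x∈TS)
    ... | inj₂ (m , m∈mid , m~x) = on-line∩TS (T'-neighbour-on-line m∈mid (TS⊆T' x∈TS) m~x) x∈TS

  ∣X∣≤2 : ∀ {x₀} → x₀ ∈ X → ∣ X ∣ ≤ 2
  ∣X∣≤2 {x₀} x₀∈X with nonempty? (F ∩ T')
  ... | no F∩T'≡∅ = ⊆⁅x,y⁆⇒∣p∣≤2 {y = x₀} λ x∈X → inj₁ (off-T'-attachment-unique off-T' x∈X x₀∈X)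
    where
    off-T' : ∀ {v} → v ∈ F → v ∉ T'
    off-T' v∈F v∈T' = F∩T'≡∅ (_ , x∈p∩q⁺ (v∈F , v∈T'))
  ... | yes (v , v∈F∩T') with x∈p∩q⁻ F T' v∈F∩T'
  ...   | v∈F , v∈T' =
    -- The skeleton only yields ¬ ¬ (a long maximal line through v); the goal is decidable.
    decidable-stable (∣ X ∣ ≤? 2) λ ∣X∣≰2 →
      F∉TS v∈F (proj₂ (sk v) (v∈T' , λ (ps , long , inner) → ∣X∣≰2 (via-line long inner)))
    where
    via-line : ∀ {ps} → LongMaximalLine G R T' ps → Inner G R T' v ps → ∣ X ∣ ≤ 2
    via-line long inner with inner⇒middle inner
    ... | a , b , mid , refl , v∈mid = ⊆⁅x,y⁆⇒∣p∣≤2 (line-attachments long v∈mid v∈F)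

final⇒nonempty : ∀ {n} {G : Graph n} {η R} → IsTree G → η < 1ℚ → Final G η R → Fin n → Nonempty R
final⇒nonempty {suc m} {G} {η} {R} tree η<1 final _ with nonempty? R
... | yes R≢∅ = R≢∅
... | no  R≡∅ = ⊥-elim (final (∁ R) whole big)
  where
  everywhere : ∀ {x} → x ∈ ∁ R
  everywhere = x∉p⇒x∈∁p λ x∈R → R≡∅ (_ , x∈R)
  whole : IsComponent G (∁ R) (∁ R)
  whole = record
    { sub       = λ x∈ → x∈
    ; nonempty  = zero , everywhere
    ; connected = λ u v _ _ → walk-mono G (λ _ → everywhere) (IsTree.connected tree u v)
    ; closed    = λ _ _ _ v∈ _ → v∈
    }
  ∣∁R∣≡n : ∣ ∁ R ∣ ≡ suc m
  ∣∁R∣≡n = trans (∣∁p∣≡n∸∣p∣ R) (cong (suc m ∸_) (trans (cong ∣_∣ (Empty-unique R≡∅)) (∣⊥∣≡0 (suc m))))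
  big : Big G η (∁ R)
  big = subst (λ k → η * (+ suc m / 1) < + k / 1) (sym ∣∁R∣≡n)
              (q<1⇒q*r<r (+ suc m / 1) {{normalize-pos (suc m) 1}} η<1)

lemma8 : (n D : ℕ) (T : Graph n) (η : ℚ) → IsTree T → MaxDegree≤ T D
    → 0ℚ < η → η < 1ℚ
    → (R : Subset n) → Reach T η R → Final T η R
    → (T' : Subset n) → SmallestSubtree T R T'
    → (TS : Subset n) → IsSkeleton T R T' TS
    → (F : Subset n) → IsComponent T (∁ TS) F
    → ∣ nbrSet T F ∩ TS ∣ ≡ 1 ⊎ ∣ nbrSet T F ∩ TS ∣ ≡ 2
lemma8 n D T η tree _ _ η<1 R _ final T' (R⊆T' , T'-conn , _) TS sk F comp =
  1≤k≤2⇒k≡1⊎k≡2 (x∈p⇒1≤∣p∣ (proj₂ attachment)) (∣X∣≤2 (proj₂ attachment))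
  where
  open Skeleton tree sk
  open Attachments tree T'-conn sk comp
  R≢∅ : Nonempty R
  R≢∅ = final⇒nonempty tree η<1 final (proj₁ (IsComponent.nonempty comp))
  attachment : ∃ λ x₀ → x₀ ∈ X
  attachment = attachment-exists (R⊆TS R⊆T' (proj₂ R≢∅))
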